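{- The space minor relation on (finite) 2-complexes is well-founded: there is no infinite sequence $C_0,C_1,C_2,\dots$ of 2-complexes such that each $C_{i+1}$ is obtained from $C_i$ by a single space minor operation, where one excludes splitting a vertex whose link graph is connected and deleting an edge incident with only a single face.
   Context: Graphs may have loops and parallel edges. A 2-complex is a finite graph together with a set of closed trails (sequences of distinct edges, each starting where the previous ends, the last ending where the first starts), called faces; every vertex and edge lies in some face. The size of a face is its number of edges. The link graph $L(v)$ at $v$ has one vertex per non-loop edge at $v$, two per loop at $v$, and one edge per traversal of a face through $v$ (a pair of cyclically consecutive edges of the face meeting at $v$), joining the corresponding vertices. The space minor operations are: (1) contracting an edge $e$ that is not a loop (identify its endvertices, delete $e$ from all faces, delete $e$); (2) deleting a face (together with all edges and vertices incident only with that face); (3) contracting a face $f$ of size two whose two edges are not loops (replace $f$ and its two edges by a single edge with the same endvertices, incident with all faces that were incident with either of the two edges), or a face $f$ of size one (its edge $\ell$ is a loop; delete $f$, delete $\ell$ from all other faces and delete $\ell$); if afterwards a face traverses an edge twice consecutively in opposite directions these two traversals are omitted, and faces with no edges are deleted; (4) splitting a vertex $v$: replace $v$ by one new vertex for each connected component $K$ of $L(v)$, incident with the edges and faces in $K$; (5) deleting an edge $e$: replace $e$ by parallel edges, one for each face incidence of $e$, each incident with precisely that one face. A space minor is obtained by successive such operations. -}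

module Defs where

open import Data.Nat using (ℕ; zero; suc)
open import Data.Fin using (Fin) renaming (_≟_ to _≟ᶠ_)
open import Data.Bool using (Bool; true; false; not; if_then_else_)
open import Data.Maybe using (Maybe; just; nothing)
open import Data.Product using (Σ; ∃; ∃-syntax; _×_; _,_; proj₁; proj₂)
open import Data.Sum using (_⊎_)
open import Data.List using (List; []; _∷_; _++_; map; take; drop; reverse; length; lookup; removeAt; tabulate; filter)
open import Data.List.Relation.Unary.All using (All)
open import Data.List.Relation.Unary.Any using (Any)
open import Data.List.Relation.Unary.Unique.Propositional using (Unique)
open import Data.List.Relation.Binary.Pointwise using (Pointwise)
open import Data.List.Relation.Binary.Permutation.Propositional using (_↭_)
open import Relation.Binary.Construct.Closure.ReflexiveTransitive using (Star)
open import Relation.Binary.Construct.Closure.Equivalence using (EqClosure)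
open import Relation.Binary.PropositionalEquality using (_≡_; _≢_)
open import Relation.Nullary using (¬_; does)
open import Relation.Unary using (Pred)
open import Function using (_∘_)
open import Data.Empty using () renaming (⊥ to ⊥')

-- A traversal of an edge is a pair (x , d): d = true means traversing x
-- from (end x false) to (end x true), d = false the other way round.
-- A face is a (cyclic) list of traversals.

Trav : ℕ → Set
Trav n = Fin n × Bool

FaceW : ℕ → Set
FaceW n = List (Trav n)

module _ {nV nE : ℕ} (end : Fin nE → Bool → Fin nV) where

  tl hd : Trav nE → Fin nV
  tl (x , d) = end x (not d)
  hd (x , d) = end x d

  Walk : Fin nV → FaceW nE → Fin nV → Set
  Walk u []       u' = u ≡ u'
  Walk u (p ∷ ps) u' = tl p ≡ u × Walk (hd p) ps u'

  ClosedTrail : FaceW nE → Set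
  ClosedTrail w = w ≢ [] × Unique (map proj₁ w) × ∃[ u ] Walk u w u

  VertIn : Fin nV → FaceW nE → Set
  VertIn u w = Any (λ p → ∃[ b ] end (proj₁ p) b ≡ u) w

EdgeIn : ∀ {n} → Fin n → FaceW n → Set
EdgeIn x w = Any (λ p → proj₁ p ≡ x) w

record Complex : Set where
  field
    nV nE  : ℕ
    end    : Fin nE → Bool → Fin nV
    faces  : List (FaceW nE)
    trails : All (ClosedTrail end) faces
    edgeCov : ∀ x → Any (EdgeIn x) faces
    vertCov : ∀ u → Any (VertIn end u) faces

open Complex

Face : Complex → Set
Face C = FaceW (nE C)

FIx : Complex → Set
FIx C = Fin (length (faces C))

face : (C : Complex) → FIx C → Face C
face C i = lookup (faces C) i

IsLoop : (C : Complex) → Fin (nE C) → Set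
IsLoop C x = end C x false ≡ end C x true

-- Faces up to rotation and reversal (a closed trail has no
-- distinguished start and no distinguished direction)

flipT : ∀ {n} → Trav n → Trav n
flipT (x , d) = (x , not d)

rotate : ∀ {A : Set} → ℕ → List A → List A
rotate k w = drop k w ++ take k w

revF : ∀ {n} → FaceW n → FaceW n
revF w = reverse (map flipT w)

FaceEq : ∀ {n} → FaceW n → FaceW n → Set
FaceEq w w' = ∃[ k ] (w' ≡ rotate k w ⊎ w' ≡ rotate k (revF w))

FacesEq : ∀ {n} → List (FaceW n) → List (FaceW n) → Set
FacesEq {n} xs ys = Σ (List (FaceW n)) λ ms → Pointwise FaceEq xs ms × (ms ↭ ys)

-- relabelling edges: ρ x = just (y , β) sends edge x to edge y, with
-- β = true if the orientation of ends is kept (end y b ↔ end x b) and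
-- β = false if reversed; ρ x = nothing deletes x from faces.
oe : Bool → Bool → Bool
oe β b = if β then b else not b

renameF : ∀ {m n} → (Fin m → Maybe (Fin n × Bool)) → FaceW m → FaceW n
renameF ρ []            = []
renameF ρ ((x , d) ∷ w) with ρ x
... | nothing      = renameF ρ w
... | just (y , β) = (y , oe β d) ∷ renameF ρ w

Cancel1 : ∀ {n} → FaceW n → FaceW n → Set
Cancel1 {n} w w' = Σ (Trav n) λ p → FaceEq w (p ∷ flipT p ∷ w')

CycRed : ∀ {n} → FaceW n → FaceW n → Set
CycRed w w' = Star Cancel1 w w' × ¬ (∃[ w'' ] Cancel1 w' w'')

isNonEmpty : ∀ {A : Set} → List A → Bool
isNonEmpty []      = false
isNonEmpty (_ ∷ _) = true

ReducedFaces : ∀ {n} → List (FaceW n) → List (FaceW n) → Set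
ReducedFaces {n} ws ds = Σ (List (FaceW n)) λ ls →
  Pointwise CycRed ws ls × FacesEq (filterNE ls) ds
  where
  filterNE : List (FaceW n) → List (FaceW n)
  filterNE []       = []
  filterNE (l ∷ ls) = if isNonEmpty l then l ∷ filterNE ls else filterNE ls

EndsOK : (C D : Complex) → (Fin (nV C) → Maybe (Fin (nV D)))
       → (Fin (nE C) → Maybe (Fin (nE D) × Bool)) → Set
EndsOK C D φ ρ = ∀ x y β b → ρ x ≡ just (y , β) →
  just (end D y (oe β b)) ≡ φ (end C x b)

EdgeMapOK : (C D : Complex) → (Fin (nE C) → Maybe (Fin (nE D) × Bool))
          → Pred (Fin (nE C)) _ → (Fin (nE C) → Fin (nE C) → Set) → Set
EdgeMapOK C D ρ Drop Same =
    (∀ x → ρ x ≡ nothing → Drop x)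
  × (∀ x → Drop x → ρ x ≡ nothing)
  × (∀ x x' y y' β β' → ρ x ≡ just (y , β) → ρ x' ≡ just (y' , β') →
       (y ≡ y' → Same x x') × (Same x x' → y ≡ y'))
  × (∀ y → ∃[ x ] ∃[ β ] ρ x ≡ just (y , β))

VBij : (C D : Complex) → (Fin (nV C) → Fin (nV D)) → Set
VBij C D φ = (∀ u u' → φ u ≡ φ u' → u ≡ u') × (∀ w → ∃[ u ] φ u ≡ w)

-- The space minor operations, as relations "D is (isomorphic to) the
-- result of applying the operation to C".

record ContractEdge (C D : Complex) : Set where
  field
    e      : Fin (nE C)
    nonloop : ¬ IsLoop C e
    φ      : Fin (nV C) → Fin (nV D)
    φ-onto : ∀ w → ∃[ u ] φ u ≡ w
    φ-eq   : ∀ u u' → φ u ≡ φ u' →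
               u ≡ u' ⊎ (u ≡ end C e false × u' ≡ end C e true)
                      ⊎ (u ≡ end C e true × u' ≡ end C e false)
    φ-id   : φ (end C e false) ≡ φ (end C e true)
    ρ      : Fin (nE C) → Maybe (Fin (nE D) × Bool)
    ρ-ok   : EdgeMapOK C D ρ (_≡ e) _≡_
    ends   : EndsOK C D (just ∘ φ) ρ
    facesD : FacesEq (map (renameF ρ) (faces C)) (faces D)

record DeleteFace (C D : Complex) : Set where
  field
    i      : FIx C
    φ      : Fin (nV C) → Maybe (Fin (nV D))
    φ-del  : ∀ u → φ u ≡ nothing → ∀ j → j ≢ i → ¬ VertIn (end C) u (face C j)
    φ-keep : ∀ u → (∀ j → j ≢ i → ¬ VertIn (end C) u (face C j)) → φ u ≡ nothing
    φ-inj  : ∀ u u' w → φ u ≡ just w → φ u' ≡ just w → u ≡ u'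
    φ-onto : ∀ w → ∃[ u ] φ u ≡ just w
    ρ      : Fin (nE C) → Maybe (Fin (nE D) × Bool)
    ρ-ok   : EdgeMapOK C D ρ (λ x → ∀ j → j ≢ i → ¬ EdgeIn x (face C j)) _≡_
    ends   : EndsOK C D φ ρ
    facesD : FacesEq (map (renameF ρ) (removeAt (faces C) i)) (faces D)

record ContractFace2 (C D : Complex) : Set where
  field
    i      : FIx C
    a b    : Fin (nE C)
    da db  : Bool
    shape  : face C i ≡ (a , da) ∷ (b , db) ∷ []
    a-nl   : ¬ IsLoop C a
    b-nl   : ¬ IsLoop C b
    φ      : Fin (nV C) → Fin (nV D)
    φ-bij  : VBij C D φ
    ρ      : Fin (nE C) → Maybe (Fin (nE D) × Bool)
    ρ-ok   : EdgeMapOK C D ρ (λ _ → ⊥') (λ x x' → x ≡ x' ⊎ (x ≡ a × x' ≡ b) ⊎ (x ≡ b × x' ≡ a))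
    ends   : EndsOK C D (just ∘ φ) ρ
    facesD : ReducedFaces (map (renameF ρ) (removeAt (faces C) i)) (faces D)

record ContractFace1 (C D : Complex) : Set where
  field
    i      : FIx C
    ℓ      : Fin (nE C)
    d      : Bool
    shape  : face C i ≡ (ℓ , d) ∷ []
    φ      : Fin (nV C) → Fin (nV D)
    φ-bij  : VBij C D φ
    ρ      : Fin (nE C) → Maybe (Fin (nE D) × Bool)
    ρ-ok   : EdgeMapOK C D ρ (_≡ ℓ) _≡_
    ends   : EndsOK C D (just ∘ φ) ρ
    facesD : ReducedFaces (map (renameF ρ) (removeAt (faces C) i)) (faces D)

-- link graph L(v): vertices are the edge-ends (x , b) at v (so one per
-- non-loop edge at v and two per loop at v); every pair p , q of
-- cyclically consecutive traversals of a face gives an edge joining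
-- the head-end of p and the tail-end of q (at the common vertex).
LinkV : (C : Complex) → Fin (nV C) → Set
LinkV C v = Σ (Fin (nE C) × Bool) λ xb → end C (proj₁ xb) (proj₂ xb) ≡ v

data Consec {A : Set} : List A → A → A → Set where
  here  : ∀ {x y xs} → Consec (x ∷ y ∷ xs) x y
  there : ∀ {z x y xs} → Consec xs x y → Consec (z ∷ xs) x y

CycConsec : ∀ {A : Set} → List A → A → A → Set
CycConsec w p q = Consec (w ++ take 1 w) p q

LinkAdj : (C : Complex) → Fin (nE C) × Bool → Fin (nE C) × Bool → Set
LinkAdj C a b = Any (λ w → ∃[ p ] ∃[ q ] CycConsec w p q × a ≡ p × b ≡ flipT q) (faces C)

LinkConn : (C : Complex) (v : Fin (nV C)) → LinkV C v → LinkV C v → Set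
LinkConn C v a b = EqClosure (LinkAdj C) (proj₁ a) (proj₁ b)

record SplitVertex (C D : Complex) : Set where
  field
    v      : Fin (nV C)
    disconnected : ∃[ a ] ∃[ b ] ¬ LinkConn C v a b
    φ      : Fin (nV C) → Fin (nV D)          -- used on vertices ≠ v
    η      : LinkV C v → Fin (nV D)           -- new vertex of the component
    φ-inj  : ∀ u u' → u ≢ v → u' ≢ v → φ u ≡ φ u' → u ≡ u'
    η-comp : ∀ a b → (η a ≡ η b → LinkConn C v a b) × (LinkConn C v a b → η a ≡ η b)
    disj   : ∀ u a → u ≢ v → φ u ≢ η a
    onto   : ∀ w → (∃[ u ] u ≢ v × φ u ≡ w) ⊎ (∃[ a ] η a ≡ w)
    ρ      : Fin (nE C) → Fin (nE D) × Bool
    ρ-inj  : ∀ x x' → proj₁ (ρ x) ≡ proj₁ (ρ x') → x ≡ x'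
    ρ-onto : ∀ y → ∃[ x ] proj₁ (ρ x) ≡ y
    ends-v : ∀ x b (p : end C x b ≡ v) →
               end D (proj₁ (ρ x)) (oe (proj₂ (ρ x)) b) ≡ η ((x , b) , p)
    ends-o : ∀ x b → end C x b ≢ v →
               end D (proj₁ (ρ x)) (oe (proj₂ (ρ x)) b) ≡ φ (end C x b)
    facesD : FacesEq (map (renameF (just ∘ ρ)) (faces C)) (faces D)

upd : ∀ {m n} → (Fin m → Maybe (Fin n × Bool)) → Fin m → Fin n × Bool
    → Fin m → Maybe (Fin n × Bool)
upd ρ e c x = if does (x ≟ᶠ e) then just c else ρ x

-- (5) deleting an edge e incident with at least two faces: e is replaced
-- by parallel edges γ j, one for each face j containing e
record DeleteEdge (C D : Complex) : Set where
  field
    e      : Fin (nE C)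
    two    : ∃[ j ] ∃[ j' ] j ≢ j' × EdgeIn e (face C j) × EdgeIn e (face C j')
    φ      : Fin (nV C) → Fin (nV D)
    φ-bij  : VBij C D φ
    ρ      : Fin (nE C) → Maybe (Fin (nE D) × Bool)
    ρ-del  : ∀ x → (ρ x ≡ nothing → x ≡ e) × (x ≡ e → ρ x ≡ nothing)
    ρ-inj  : ∀ x x' y β β' → ρ x ≡ just (y , β) → ρ x' ≡ just (y , β') → x ≡ x'
    γ      : FIx C → Fin (nE D) × Bool
    γ-inj  : ∀ j j' → EdgeIn e (face C j) → EdgeIn e (face C j') →
               proj₁ (γ j) ≡ proj₁ (γ j') → j ≡ j'
    disj   : ∀ x y β j → ρ x ≡ just (y , β) → EdgeIn e (face C j) → proj₁ (γ j) ≢ y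
    onto   : ∀ y → (∃[ x ] ∃[ β ] ρ x ≡ just (y , β))
                 ⊎ (∃[ j ] EdgeIn e (face C j) × proj₁ (γ j) ≡ y)
    ends   : EndsOK C D (just ∘ φ) ρ
    ends-γ : ∀ j b → EdgeIn e (face C j) →
               end D (proj₁ (γ j)) (oe (proj₂ (γ j)) b) ≡ φ (end C e b)
    facesD : FacesEq (tabulate (λ j → renameF (upd ρ e (γ j)) (face C j))) (faces D)

data Step (C D : Complex) : Set where
  contractEdge  : ContractEdge C D → Step C D
  deleteFace    : DeleteFace C D → Step C D
  contractFace2 : ContractFace2 C D → Step C D
  contractFace1 : ContractFace1 C D → Step C D
  splitVertex   : SplitVertex C D → Step C D
  deleteEdge    : DeleteEdge C D → Step C D

module Submission where

-- Write L(C) for the total size of the faces of C (the sum of their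
-- lengths) and N(C) for the number of edges plus the number of vertices.
-- Contracting an edge, deleting a face and contracting a face of size one
-- or two strictly decrease L.  Splitting a vertex whose link is
-- disconnected, and deleting an edge that lies in two faces, keep L and
-- strictly increase N: the first creates a second vertex in place of v,
-- the second a second edge in place of e.  Every edge and vertex lies on
-- a face, so N(C) ≤ 3·L(C); hence the measure (L(C) , 3·L(C) ∸ N(C))
-- decreases lexicographically along every step, and a well-founded order
-- admits no infinite descending sequence.

open import Defs
open import Data.Nat using (ℕ; suc)
open import Data.Product using (Σ)
open import Relation.Nullary using (¬_)

open import Data.Nat using (zero; _+_; _*_; _∸_; _≤_; _<_; z≤n; s≤s)
open import Data.Nat.Properties
  using (≤-refl; ≤-reflexive; ≤-trans; module ≤-Reasoning; m≤n+m; m<n+m;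
         +-mono-≤; +-mono-≤-<; +-mono-<-≤; +-monoʳ-<; *-suc; *-zeroʳ; *-identityˡ; ∸-monoʳ-<)
open import Data.Nat.ListAction using (sum)
open import Data.Nat.ListAction.Properties using (sum-↭)
open import Data.Nat.Induction using (<-wellFounded)
open import Data.Fin using (Fin; zero; suc; _≟_)
open import Data.Fin.Properties using (injective⇒≤)
open import Data.Bool using (Bool; true; false)
open import Data.Maybe using (Maybe; just; nothing)
open import Data.Product using (∃-syntax; _×_; _,_; proj₁; proj₂)
open import Data.Product.Relation.Binary.Lex.Strict using (×-Lex; ×-wellFounded)
open import Data.Sum using (inj₁; inj₂)
open import Data.Empty using (⊥-elim)
open import Function using (_∘_; _on_)
open import Data.List
  using (List; []; _∷_; _++_; map; take; drop; reverse; length; lookup;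
         removeAt; tabulate; concat; concatMap)
open import Data.List.Properties
  using (length-++; length-++-comm; take++drop≡id; length-reverse; length-map;
         map-∘; map-cong; map-tabulate; tabulate-cong; tabulate-lookup)
import Data.List.Relation.Unary.All as All
open import Data.List.Relation.Unary.Any using (Any; here; there; index)
import Data.List.Relation.Unary.Any as Any
open import Data.List.Relation.Unary.Any.Properties using (lookup-index; concat⁺)
open import Data.List.Membership.Propositional using (_∈_)
open import Data.List.Membership.Propositional.Properties using (∈-lookup; ∈-concatMap⁺)
open import Data.List.Relation.Binary.Pointwise using (Pointwise; []; _∷_; Pointwise-≡⇒≡)
import Data.List.Relation.Binary.Pointwise as Pointwise
open import Data.List.Relation.Binary.Permutation.Propositional using (↭-refl)
import Data.List.Relation.Binary.Permutation.Propositional.Properties as Perm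
open import Relation.Binary.Construct.Closure.ReflexiveTransitive using (Star; ε; _◅_)
import Relation.Binary.Construct.On as On
open import Relation.Binary.Core using (Rel)
open import Relation.Binary.PropositionalEquality
  using (_≡_; _≢_; refl; sym; trans; cong; cong₂; subst; module ≡-Reasoning)
open import Relation.Nullary using (Dec; yes; no)
open import Induction.WellFounded using (WellFounded)
open import Induction.InfiniteDescent
  using (InfiniteDescendingSequence; InfiniteDescendingSequenceFrom; Descent; descent∧wf⇒empty)

open Complex

-- A well-founded relation admits no infinite descending sequence: the
-- tails of such a sequence witness that there is always a smaller start.
noInfiniteDescent : ∀ {a r} {A : Set a} {_<_ : Rel A r} → WellFounded _<_ →
                    (f : ℕ → A) → ¬ InfiniteDescendingSequence _<_ f
noInfiniteDescent {_<_ = _<_} wf f desc =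
  descent∧wf⇒empty startsDescent wf (f 0) (f , refl , desc)
  where
  startsDescent : Descent _<_ (λ x → ∃[ g ] InfiniteDescendingSequenceFrom _<_ g x)
  startsDescent (g , refl , d) = g 1 , d 0 , (g ∘ suc , refl , d ∘ suc)

size : ∀ {n} → List (FaceW n) → ℕ
size ws = sum (map length ws)

length-concat : ∀ {A : Set} (xss : List (List A)) → length (concat xss) ≡ sum (map length xss)
length-concat []         = refl
length-concat (xs ∷ xss) = trans (length-++ xs) (cong (length xs +_) (length-concat xss))

rotate-length : ∀ {A : Set} k (w : List A) → length (rotate k w) ≡ length w
rotate-length k w = begin
  length (drop k w ++ take k w) ≡⟨ length-++-comm (drop k w) (take k w) ⟩
  length (take k w ++ drop k w) ≡⟨ cong length (take++drop≡id k w) ⟩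
  length w                      ∎
  where open ≡-Reasoning

revF-length : ∀ {n} (w : FaceW n) → length (revF w) ≡ length w
revF-length w = trans (length-reverse (map flipT w)) (length-map flipT w)

faceEq-length : ∀ {n} {w w' : FaceW n} → FaceEq w w' → length w ≡ length w'
faceEq-length {w = w} (k , inj₁ refl) = sym (rotate-length k w)
faceEq-length {w = w} (k , inj₂ refl) = sym (trans (rotate-length k (revF w)) (revF-length w))

facesEq-size : ∀ {n} {ws ds : List (FaceW n)} → FacesEq ws ds → size ws ≡ size ds
facesEq-size (_ , eqs , perm) =
  trans (cong sum (Pointwise-≡⇒≡ (Pointwise.map⁺ length length (Pointwise.map faceEq-length eqs))))
        (sum-↭ (Perm.map⁺ length perm))

-- each cancellation of a pair of opposite traversals removes two edges
cycRed-length : ∀ {n} {w w' : FaceW n} → CycRed w w' → length w' ≤ length w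
cycRed-length (steps , _) = shortens steps
  where
  shortens : ∀ {w w'} → Star Cancel1 w w' → length w' ≤ length w
  shortens ε               = ≤-refl
  shortens ((_ , eq) ◅ s) =
    ≤-trans (shortens s) (≤-trans (m≤n+m _ 2) (≤-reflexive (sym (faceEq-length eq))))

cycRed-size : ∀ {n} {ws ls : List (FaceW n)} → Pointwise CycRed ws ls → size ls ≤ size ws
cycRed-size []           = ≤-refl
cycRed-size (red ∷ reds) = +-mono-≤ (cycRed-length red) (cycRed-size reds)

-- omitting the faces without edges keeps the total size; the omission is
-- internal to ReducedFaces, so the statement refers to its components
omitEmpty-size : ∀ {n} {ws ds : List (FaceW n)} (r : ReducedFaces ws ds) →
                 size (proj₁ (proj₂ (proj₂ r))) ≡ size (proj₁ r)
omitEmpty-size {ws = []} ([] , [] , [] , [] , _) = refl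
omitEmpty-size {ws = _ ∷ _} ([] ∷ ls , _ ∷ reds , ms , eqs , perm) =
  omitEmpty-size (ls , reds , ms , eqs , perm)
omitEmpty-size {ws = _ ∷ _} ((t ∷ l) ∷ ls , _ ∷ reds , m ∷ ms , eq ∷ eqs , _) =
  cong₂ _+_ (sym (faceEq-length eq)) (omitEmpty-size (ls , reds , ms , eqs , ↭-refl))

reducedFaces-size : ∀ {n} {ws ds : List (FaceW n)} → ReducedFaces ws ds → size ds ≤ size ws
reducedFaces-size {ws = ws} {ds} r@(ls , reds , ms , _ , perm) = begin
  size ds ≡⟨ sym (sum-↭ (Perm.map⁺ length perm)) ⟩
  size ms ≡⟨ omitEmpty-size r ⟩
  size ls ≤⟨ cycRed-size reds ⟩
  size ws ∎
  where open ≤-Reasoning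

renameF-length-≤ : ∀ {m n} (ρ : Fin m → Maybe (Fin n × Bool)) (w : FaceW m) →
                   length (renameF ρ w) ≤ length w
renameF-length-≤ ρ []            = z≤n
renameF-length-≤ ρ ((x , d) ∷ w) with ρ x
... | nothing = ≤-trans (renameF-length-≤ ρ w) (m≤n+m _ 1)
... | just _  = s≤s (renameF-length-≤ ρ w)

renameF-length-< : ∀ {m n} (ρ : Fin m → Maybe (Fin n × Bool)) {e : Fin m} → ρ e ≡ nothing →
                   ∀ {w} → EdgeIn e w → length (renameF ρ w) < length w
renameF-length-< ρ ρe≡nothing {_ ∷ w} (here refl) rewrite ρe≡nothing =
  s≤s (renameF-length-≤ ρ w)
renameF-length-< ρ ρe≡nothing {(x , d) ∷ w} (there e∈w) with ρ x
... | nothing = ≤-trans (renameF-length-< ρ ρe≡nothing e∈w) (m≤n+m _ 1)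
... | just _  = s≤s (renameF-length-< ρ ρe≡nothing e∈w)

renameF-length-≡ : ∀ {m n} (ρ : Fin m → Maybe (Fin n × Bool)) → (∀ x → ρ x ≢ nothing) →
                   (w : FaceW m) → length (renameF ρ w) ≡ length w
renameF-length-≡ ρ total []            = refl
renameF-length-≡ ρ total ((x , d) ∷ w) with ρ x in ρx
... | nothing = ⊥-elim (total x ρx)
... | just _  = cong suc (renameF-length-≡ ρ total w)

module _ {m n} (f : FaceW m → FaceW n) where

  size-map-≤ : (∀ w → length (f w) ≤ length w) → ∀ ws → size (map f ws) ≤ size ws
  size-map-≤ shorter []       = z≤n
  size-map-≤ shorter (w ∷ ws) = +-mono-≤ (shorter w) (size-map-≤ shorter ws)

  size-map-< : (∀ w → length (f w) ≤ length w) →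
               ∀ {ws} → Any (λ w → length (f w) < length w) ws → size (map f ws) < size ws
  size-map-< shorter {w ∷ ws} (here w-shortened) = +-mono-≤ w-shortened (size-map-≤ shorter ws)
  size-map-< shorter {w ∷ ws} (there shortened)  = +-mono-≤-< (shorter w) (size-map-< shorter shortened)

  size-map-≡ : (∀ w → length (f w) ≡ length w) → ∀ ws → size (map f ws) ≡ size ws
  size-map-≡ same ws = cong sum (trans (sym (map-∘ ws)) (map-cong same ws))

size-tabulate : ∀ {m n} (ws : List (FaceW m)) (g : Fin (length ws) → FaceW n) →
                (∀ j → length (g j) ≡ length (lookup ws j)) → size (tabulate g) ≡ size ws
size-tabulate ws g same = begin
  sum (map length (tabulate g))            ≡⟨ cong sum (map-tabulate g length) ⟩
  sum (tabulate (length ∘ g))              ≡⟨ cong sum (tabulate-cong same) ⟩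
  sum (tabulate (length ∘ lookup ws))      ≡⟨ cong sum (map-tabulate (lookup ws) length) ⟨
  sum (map length (tabulate (lookup ws)))  ≡⟨ cong size (tabulate-lookup ws) ⟩
  size ws                                  ∎
  where open ≡-Reasoning

removeAt-size : ∀ {n} (ws : List (FaceW n)) (i : Fin (length ws)) → lookup ws i ≢ [] →
                size (removeAt ws i) < size ws
removeAt-size ([] ∷ ws)      zero    nonempty = ⊥-elim (nonempty refl)
removeAt-size ((t ∷ w) ∷ ws) zero    _        = m<n+m (size ws) (s≤s z≤n)
removeAt-size (w ∷ ws)       (suc i) nonempty = +-monoʳ-< (length w) (removeAt-size ws i nonempty)

L : Complex → ℕ
L C = size (faces C)

N : Complex → ℕ
N C = nE C + nV C

face-nonempty : (C : Complex) (i : FIx C) → face C i ≢ []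
face-nonempty C i = proj₁ (All.lookup (trails C) (∈-lookup i))

removeFace-shrinks : ∀ {n} (C : Complex) (i : FIx C) (ρ : Fin (nE C) → Maybe (Fin n × Bool)) →
                     size (map (renameF ρ) (removeAt (faces C) i)) < L C
removeFace-shrinks C i ρ = begin-strict
  size (map (renameF ρ) (removeAt (faces C) i)) ≤⟨ size-map-≤ (renameF ρ) (renameF-length-≤ ρ) (removeAt (faces C) i) ⟩
  size (removeAt (faces C) i)                   <⟨ removeAt-size (faces C) i (face-nonempty C i) ⟩
  L C                                           ∎
  where open ≤-Reasoning

coverBound : ∀ {m} (xs : List (Fin m)) → (∀ y → y ∈ xs) → m ≤ length xs
coverBound xs covers = injective⇒≤ {f = λ y → index (covers y)} positions-differ
  where
  positions-differ : ∀ {y y'} → index (covers y) ≡ index (covers y') → y ≡ y'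
  positions-differ {y} {y'} eq = begin
    y                             ≡⟨ lookup-index (covers y) ⟩
    lookup xs (index (covers y))  ≡⟨ cong (lookup xs) eq ⟩
    lookup xs (index (covers y')) ≡⟨ lookup-index (covers y') ⟨
    y'                            ∎
    where open ≡-Reasoning

module Incidences {n : ℕ} {X : Set} (k : ℕ) (inc : Trav n → List X)
                  (inc-length : ∀ p → length (inc p) ≡ k) where

  incidences : List (FaceW n) → List X
  incidences ws = concatMap inc (concat ws)

  incidences-length : ∀ ws → length (incidences ws) ≡ k * size ws
  incidences-length ws = trans (perTraversal (concat ws)) (cong (k *_) (length-concat ws))
    where
    perTraversal : ∀ ts → length (concatMap inc ts) ≡ k * length ts
    perTraversal []       = sym (*-zeroʳ k)
    perTraversal (t ∷ ts) = begin
      length (inc t ++ concatMap inc ts)         ≡⟨ length-++ (inc t) ⟩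
      length (inc t) + length (concatMap inc ts) ≡⟨ cong₂ _+_ (inc-length t) (perTraversal ts) ⟩
      k + k * length ts                          ≡⟨ *-suc k (length ts) ⟨
      k * suc (length ts)                        ∎
      where open ≡-Reasoning

  incidences-∈ : ∀ {Q : Trav n → Set} {y} → (∀ p → Q p → y ∈ inc p) →
                 ∀ {ws} → Any (Any Q) ws → y ∈ incidences ws
  incidences-∈ occurs q = ∈-concatMap⁺ inc (Any.map (occurs _) (concat⁺ q))

-- every edge lies on a face, and each traversal passes one edge
edges-bound : (C : Complex) → nE C ≤ L C
edges-bound C = begin
  nE C                           ≤⟨ coverBound (incidences (faces C)) (λ x → incidences-∈ passes (edgeCov C x)) ⟩
  length (incidences (faces C))  ≡⟨ incidences-length (faces C) ⟩
  1 * L C                        ≡⟨ *-identityˡ (L C) ⟩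
  L C                            ∎
  where
  open ≤-Reasoning
  open Incidences 1 (λ p → proj₁ p ∷ []) (λ _ → refl)
  passes : ∀ {x} (p : Trav (nE C)) → proj₁ p ≡ x → x ∈ proj₁ p ∷ []
  passes _ refl = here refl

-- every vertex lies on a face, and each traversal meets two ends
vertices-bound : (C : Complex) → nV C ≤ 2 * L C
vertices-bound C = begin
  nV C                           ≤⟨ coverBound (incidences (faces C)) (λ u → incidences-∈ meets (vertCov C u)) ⟩
  length (incidences (faces C))  ≡⟨ incidences-length (faces C) ⟩
  2 * L C                        ∎
  where
  open ≤-Reasoning
  ends : Trav (nE C) → List (Fin (nV C))
  ends p = end C (proj₁ p) false ∷ end C (proj₁ p) true ∷ []
  open Incidences 2 ends (λ _ → refl)
  meets : ∀ {u} (p : Trav (nE C)) → ∃[ b ] end C (proj₁ p) b ≡ u → u ∈ ends p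
  meets _ (false , refl) = here refl
  meets _ (true  , refl) = there (here refl)

objects-bound : (C : Complex) → N C ≤ 3 * L C
objects-bound C = +-mono-≤ (edges-bound C) (vertices-bound C)

-- contracting e deletes it from the faces, and e lies on some face
contractEdge-shrinks : ∀ {C D} → ContractEdge C D → L D < L C
contractEdge-shrinks {C} {D} s = begin-strict
  L D                                  ≡⟨ facesEq-size facesD ⟨
  size (map (renameF ρ) (faces C))     <⟨ size-map-< (renameF ρ) (renameF-length-≤ ρ)
                                            (Any.map (renameF-length-< ρ e-deleted) (edgeCov C e)) ⟩
  L C                                  ∎
  where
  open ContractEdge s
  open ≤-Reasoning
  e-deleted : ρ e ≡ nothing
  e-deleted = proj₁ (proj₂ ρ-ok) e refl

-- deleting or contracting a face removes it and never lengthens the others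
deleteFace-shrinks : ∀ {C D} → DeleteFace C D → L D < L C
deleteFace-shrinks {C} {D} s =
  subst (_< L C) (facesEq-size facesD) (removeFace-shrinks C i ρ)
  where open DeleteFace s

contractFace2-shrinks : ∀ {C D} → ContractFace2 C D → L D < L C
contractFace2-shrinks {C} {D} s = ≤-trans (s≤s (reducedFaces-size facesD)) (removeFace-shrinks C i ρ)
  where open ContractFace2 s

contractFace1-shrinks : ∀ {C D} → ContractFace1 C D → L D < L C
contractFace1-shrinks {C} {D} s = ≤-trans (s≤s (reducedFaces-size facesD)) (removeFace-shrinks C i ρ)
  where open ContractFace1 s

-- Splitting v creates distinct vertices η a and η b for the two link
-- components of the disconnected pair a , b: v goes to η a, every other
-- vertex u to φ u, and one extra point to η b.
splitVertex-vertices : ∀ {C D} → SplitVertex C D → nV C < nV D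
splitVertex-vertices {C} {D} s = injective⇒≤ {f = embed} embed-injective
  where
  open SplitVertex s
  a = proj₁ disconnected
  b = proj₁ (proj₂ disconnected)

  image : (u : Fin (nV C)) → Dec (u ≡ v) → Fin (nV D)
  image u (yes _) = η a
  image u (no _)  = φ u

  image-injective : ∀ u u' du du' → image u du ≡ image u' du' → u ≡ u'
  image-injective u u' (yes u≡v) (yes u'≡v) _  = trans u≡v (sym u'≡v)
  image-injective u u' (yes _)   (no u'≢v)  eq = ⊥-elim (disj u' a u'≢v (sym eq))
  image-injective u u' (no u≢v)  (yes _)    eq = ⊥-elim (disj u a u≢v eq)
  image-injective u u' (no u≢v)  (no u'≢v)  eq = φ-inj u u' u≢v u'≢v eq

  ηb-new : ∀ u du → η b ≢ image u du
  ηb-new u (yes _)   eq = proj₂ (proj₂ disconnected) (proj₁ (η-comp a b) (sym eq))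
  ηb-new u (no u≢v)  eq = disj u b u≢v (sym eq)

  embed : Fin (suc (nV C)) → Fin (nV D)
  embed zero    = η b
  embed (suc u) = image u (u ≟ v)

  embed-injective : ∀ {x y} → embed x ≡ embed y → x ≡ y
  embed-injective {zero}  {zero}   _  = refl
  embed-injective {zero}  {suc u}  eq = ⊥-elim (ηb-new u (u ≟ v) eq)
  embed-injective {suc u} {zero}   eq = ⊥-elim (ηb-new u (u ≟ v) (sym eq))
  embed-injective {suc u} {suc u'} eq = cong suc (image-injective u u' (u ≟ v) (u' ≟ v) eq)

splitVertex-grows : ∀ {C D} → SplitVertex C D → L D ≡ L C × N C < N D
splitVertex-grows {C} {D} s =
    trans (sym (facesEq-size facesD))
          (size-map-≡ (renameF (just ∘ ρ)) (renameF-length-≡ (just ∘ ρ) (λ _ ())) (faces C))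
  , +-mono-≤-< (injective⇒≤ {f = proj₁ ∘ ρ} (ρ-inj _ _)) (splitVertex-vertices s)
  where open SplitVertex s

-- Deleting e creates distinct copies γ j and γ j' of e for two faces
-- j ≠ j' through e: a surviving edge goes to its image under ρ, e to
-- γ j, and one extra point to γ j'.
deleteEdge-edges : ∀ {C D} → DeleteEdge C D → nE C < nE D
deleteEdge-edges {C} {D} s = injective⇒≤ {f = embed} embed-injective
  where
  open DeleteEdge s
  j  = proj₁ two
  j' = proj₁ (proj₂ two)
  j≢j' = proj₁ (proj₂ (proj₂ two))
  e∈j  = proj₁ (proj₂ (proj₂ (proj₂ two)))
  e∈j' = proj₂ (proj₂ (proj₂ (proj₂ two)))

  image : Maybe (Fin (nE D) × Bool) → Fin (nE D)
  image nothing        = proj₁ (γ j)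
  image (just (y , _)) = y

  image-injective : ∀ x x' → image (ρ x) ≡ image (ρ x') → x ≡ x'
  image-injective x x' eq with ρ x in ρx | ρ x' in ρx'
  ... | nothing      | nothing        = trans (proj₁ (ρ-del x) ρx) (sym (proj₁ (ρ-del x') ρx'))
  ... | nothing      | just (y' , β') = ⊥-elim (disj x' y' β' j ρx' e∈j eq)
  ... | just (y , β) | nothing        = ⊥-elim (disj x y β j ρx e∈j (sym eq))
  ... | just (y , β) | just (y' , β') = ρ-inj x x' y' β β' (subst (λ z → ρ x ≡ just (z , β)) eq ρx) ρx'

  γj'-new : ∀ x → proj₁ (γ j') ≢ image (ρ x)
  γj'-new x eq with ρ x in ρx
  ... | nothing      = j≢j' (sym (γ-inj j' j e∈j' e∈j eq))
  ... | just (y , β) = disj x y β j' ρx e∈j' eq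

  embed : Fin (suc (nE C)) → Fin (nE D)
  embed zero    = proj₁ (γ j')
  embed (suc x) = image (ρ x)

  embed-injective : ∀ {x y} → embed x ≡ embed y → x ≡ y
  embed-injective {zero}  {zero}   _  = refl
  embed-injective {zero}  {suc x}  eq = ⊥-elim (γj'-new x eq)
  embed-injective {suc x} {zero}   eq = ⊥-elim (γj'-new x (sym eq))
  embed-injective {suc x} {suc x'} eq = cong suc (image-injective x x' eq)

deleteEdge-grows : ∀ {C D} → DeleteEdge C D → L D ≡ L C × N C < N D
deleteEdge-grows {C} {D} s =
    trans (sym (facesEq-size facesD))
          (size-tabulate (faces C) _ (λ j → renameF-length-≡ (upd ρ e (γ j)) (upd-total (γ j)) (face C j)))
  , +-mono-<-≤ (deleteEdge-edges s) (injective⇒≤ {f = φ} (proj₁ φ-bij _ _))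
  where
  open DeleteEdge s
  -- the edge map of each face deletes nothing: e is sent to its copy
  upd-total : ∀ c x → upd ρ e c x ≢ nothing
  upd-total c x with x ≟ e
  ... | yes _   = λ ()
  ... | no x≢e = λ ρx≡nothing → x≢e (proj₁ (ρ-del x) ρx≡nothing)

-- room left in the bound N ≤ 3·L; it drops when N grows at fixed L
slack : Complex → ℕ
slack C = 3 * L C ∸ N C

measure : Complex → ℕ × ℕ
measure C = L C , slack C

_≺_ : Complex → Complex → Set
_≺_ = ×-Lex _≡_ _<_ _<_ on measure

≺-wellFounded : WellFounded _≺_
≺-wellFounded = On.wellFounded measure (×-wellFounded <-wellFounded <-wellFounded)

grows⇒≺ : ∀ {C D} → L D ≡ L C × N C < N D → D ≺ C
grows⇒≺ {C} {D} (same , more) = inj₂ (same , slack-drops)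
  where
  open ≤-Reasoning
  slack-drops : slack D < slack C
  slack-drops = begin-strict
    3 * L D ∸ N D  ≡⟨ cong (λ l → 3 * l ∸ N D) same ⟩
    3 * L C ∸ N D  <⟨ ∸-monoʳ-< more (subst (λ l → N D ≤ 3 * l) same (objects-bound D)) ⟩
    3 * L C ∸ N C  ∎

step-≺ : ∀ {C D} → Step C D → D ≺ C
step-≺ (contractEdge s)  = inj₁ (contractEdge-shrinks s)
step-≺ (deleteFace s)    = inj₁ (deleteFace-shrinks s)
step-≺ (contractFace2 s) = inj₁ (contractFace2-shrinks s)
step-≺ (contractFace1 s) = inj₁ (contractFace1-shrinks s)
step-≺ {C} {D} (splitVertex s) = grows⇒≺ {C} {D} (splitVertex-grows s)
step-≺ {C} {D} (deleteEdge s)  = grows⇒≺ {C} {D} (deleteEdge-grows s)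

lemma6p3 : ¬ (Σ (ℕ → Complex) λ C → ∀ i → Step (C i) (C (suc i)))
lemma6p3 (C , steps) = noInfiniteDescent ≺-wellFounded C (λ i → step-≺ (steps i))
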